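{- Let $k\ge2$ and $n\ge1$ be integers. In the Tower of Hanoi problem on the star graph $\mathrm{S}_k$, the $n$ disks can be transferred from one leaf of the graph to another leaf using at most $\mathrm{G}_{k+1}(n)$ moves, where $\mathrm{G}_{k+1}(n)$ is the generalized Frame–Stewart number with $(p_3,q_3)=(3,2)$ and $(p_i,q_i)=(2,1)$ for $4\le i\le k+1$. That is, $\mathrm{G}_{k+1}(n)$ is an upper bound on the minimum number of moves for this problem.
   Context: The star graph $\mathrm{S}_k$ has $k+1$ vertices: one center vertex adjacent to each of $k$ leaves, and no other edges. Tower of Hanoi on a graph: a peg is placed at each vertex; $n$ disks of distinct sizes initially form a pile on one peg (largest at the bottom); a move takes the topmost disk of some peg and places it on a peg that is adjacent in the graph and that is either empty or whose top disk is larger; the goal is to move all disks onto a specified destination peg. Generalized Frame–Stewart numbers: for positive integer sequences $(p_i)_{i\ge3}$, $(q_i)_{i\ge3}$, $\mathrm{G}_m(0)=0$ for $m\ge3$; $\mathrm{G}_3(n)=p_3\mathrm{G}_3(n-1)+q_3$ for $n\ge1$; and $\mathrm{G}_m(n)=\min_{1\le t\le n}\{p_m\mathrm{G}_m(n-t)+q_m\mathrm{G}_{m-1}(t)\}$ for $m\ge4$, $n\ge1$. -}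

module Defs where

open import Data.Nat using (ℕ; zero; suc; _+_; _*_; _⊔_; _⊓_; _∸_; _<_; _≤_)
open import Data.Fin using (Fin; zero; suc; toℕ; _≟_)
open import Data.Product using (Σ; _×_; _,_)
open import Data.Sum using (_⊎_)
open import Relation.Binary.PropositionalEquality using (_≡_; _≢_)
open import Relation.Nullary using (¬_)
open import Data.Unit using (⊤)
open import Data.Empty using (⊥)

-- GFS p q m n = G_m(n).  For m ≤ 2 the value is irrelevant (set to 0).
-- minOver f n = min_{1 ≤ t ≤ n} f t   (for n ≥ 1; minOver f 0 = 0 unused)
minOver : (ℕ → ℕ) → ℕ → ℕ
minOver f zero = zero
minOver f (suc zero) = f 1
minOver f (suc (suc n)) = minOver f (suc n) ⊓ f (suc (suc n))

-- G_{3+j}(n) computed with a fuel argument (fuel ≥ n suffices) so that the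
-- recursion is structural:
--   G_3(0) = 0,  G_3(n+1) = p_3 G_3(n) + q_3,
--   G_m(0) = 0,  G_m(n) = min_{1≤t≤n} { p_m G_m(n-t) + q_m G_{m-1}(t) }  (m ≥ 4).
Gf : (ℕ → ℕ) → (ℕ → ℕ) → ℕ → ℕ → ℕ → ℕ
Gf p q j zero n = 0
Gf p q j (suc f) zero = 0
Gf p q zero (suc f) (suc n) = p 3 * Gf p q zero f n + q 3
Gf p q (suc j) (suc f) (suc n) =
  minOver (λ t → p (4 + j) * Gf p q (suc j) f (suc n ∸ t) + q (4 + j) * Gf p q j (suc n) t) (suc n)

GFS' : (ℕ → ℕ) → (ℕ → ℕ) → ℕ → ℕ → ℕ
GFS' p q j n = Gf p q j n n

GFS : (ℕ → ℕ) → (ℕ → ℕ) → ℕ → ℕ → ℕ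
GFS p q (suc (suc (suc j))) n = GFS' p q j n
GFS p q _ n = 0

pStar : ℕ → ℕ
pStar 3 = 3
pStar _ = 2

qStar : ℕ → ℕ
qStar 3 = 2
qStar _ = 1

-- Star graph S_k on vertex set Fin (suc k): vertex zero is the center,
-- vertices suc i (i : Fin k) are the k leaves.  Adjacency: center -- leaf.
StarAdj : {k : ℕ} → Fin (suc k) → Fin (suc k) → Set
StarAdj zero (suc _) = ⊤
StarAdj (suc _) zero = ⊤
StarAdj _ _ = ⊥

-- Disk i : Fin n has size toℕ i (larger index = larger disk).  Since on each
-- peg the disks must be stacked with sizes decreasing upwards, a legal
-- configuration is determined by this assignment, and every assignment is legal.
Config : ℕ → ℕ → Set
Config k n = Fin n → Fin (suc k)

-- One legal move from c to c': some disk d moves from peg a to an adjacent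
-- peg b, d is topmost on a (no smaller disk on a), b has no smaller disk
-- (empty or top disk larger), and all other disks stay put.
Move : {k n : ℕ} → Config k n → Config k n → Set
Move {k} {n} c c' =
  Σ (Fin n) λ d →
    StarAdj (c d) (c' d)
    × ((e : Fin n) → toℕ e < toℕ d → (c e ≢ c d) × (c e ≢ c' d))
    × ((e : Fin n) → e ≢ d → c' e ≡ c e)

data ReachIn {k n : ℕ} : ℕ → Config k n → Config k n → Set where
  done : {m : ℕ} {c : Config k n} → ReachIn m c c
  step : {m : ℕ} {c c' c'' : Config k n} →
         Move c c' → ReachIn m c' c'' → ReachIn (suc m) c c''

pile : {k : ℕ} (n : ℕ) → Fin (suc k) → Config k n
pile n a = λ _ → a

-- We prove a stronger, recursive statement about moving a *block* of disks,
-- i.e. the disks whose sizes lie in an interval [lo, lo + s), from one leaf a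
-- to another leaf b, while every smaller disk is parked on a leaf that the
-- procedure never touches.  Besides a and b the procedure may use the centre
-- and a list of j further free leaves.  'CanMove j s m' says that this is
-- always possible in at most m moves.  After setting up move sequences up to
-- pointwise equality ('Reach'), blocks and their relocation, and the parking
-- invariant, two constructions realise the Frame–Stewart recursion:
--   * 'canMove-three' (no free leaf): for a block of n + 1 disks, move the top
--     n disks a → b, the largest a → centre, the top n disks b → a, the largest
--     centre → b, the top n disks a → b; cost 3 G + 2, the recursion for G_3;
--   * 'canMove-split' (j + 1 free leaves): move the top u disks to a free leaf
--     e (with b now free), the bottom t disks a → b using the remaining j free
--     leaves, and the top u disks e → b (with a now free); cost 2 G + G'.
-- 'towerMove' combines them along the definition of Gf, choosing the
-- minimising t, and 'theorem3' instantiates it with the whole tower and the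
-- k - 2 leaves other than the source and destination.

module Submission where

open import Defs
open import Data.Nat using (ℕ; zero; suc; _+_; _*_; _∸_; _≤_; _<_; z≤n; s≤s; _≤?_; _<?_)
open import Data.Nat.Properties
  using (≤-refl; ≤-trans; ≤-reflexive; <⇒≤; <⇒≱; ≮⇒≥; <-≤-trans; ≤-antisym; m<1+n⇒m≤n;
         m≤m+n; m≤n+m; +-assoc; +-comm; +-identityʳ; *-identityˡ; m∸n+n≡m; ∸-monoʳ-≤; ⊓-sel; suc-injective)
open import Data.Nat.Solver using (module +-*-Solver)
open import Data.Fin using (Fin; zero; suc; toℕ; fromℕ<; punchIn; punchOut)
open import Data.Fin.Properties
  using (toℕ-fromℕ<; toℕ-injective; toℕ<n; punchIn-injective; punchInᵢ≢i; punchIn-punchOut)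
  renaming (suc-injective to fsuc-injective)
open import Data.List using (List; []; _∷_; length; tabulate)
open import Data.List.Properties using (length-tabulate)
open import Data.List.Membership.Propositional using (_∈_; _∉_)
open import Data.List.Relation.Unary.Any using (here; there)
open import Data.List.Relation.Unary.All using ([]; _∷_)
open import Data.List.Relation.Unary.All.Properties using (tabulate⁺)
open import Data.List.Relation.Unary.AllPairs using ([]; _∷_)
open import Data.List.Relation.Unary.Unique.Propositional using (Unique)
open import Data.List.Relation.Unary.Unique.Propositional.Properties
  using (Unique[x∷xs]⇒x∉xs) renaming (tabulate⁺ to unique-tabulate)
open import Data.List.Relation.Binary.Permutation.Propositional
  using (_↭_; ↭-refl; ↭-sym; ↭-trans; ↭-prep; ↭-swap; ↭⇒↭ₛ)
open import Data.List.Relation.Binary.Permutation.Propositional.Properties using (∈-resp-↭)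
import Data.List.Relation.Binary.Permutation.Setoid.Properties as SetoidPermutation
open import Data.Product using (Σ; _×_; _,_; proj₁; proj₂)
open import Data.Sum using (_⊎_; inj₁; inj₂)
open import Data.Unit using (tt)
open import Data.Empty using (⊥)
open import Relation.Nullary using (¬_; Dec; yes; no; contradiction)
open import Relation.Nullary.Decidable using (_×-dec_)
open import Relation.Binary.PropositionalEquality
  using (_≡_; _≢_; _≗_; refl; sym; trans; cong; subst; subst₂; setoid)

minOver-attained : ∀ (F : ℕ → ℕ) n → Σ ℕ λ t → 1 ≤ t × t ≤ suc n × minOver F (suc n) ≡ F t
minOver-attained F zero = 1 , ≤-refl , ≤-refl , refl
minOver-attained F (suc n) with minOver-attained F n | ⊓-sel (minOver F (suc n)) (F (suc (suc n)))
... | t , 1≤t , t≤ , attained | inj₁ left = t , 1≤t , ≤-trans t≤ (m≤n+m _ 1) , trans left attained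
... | _ | inj₂ right = suc (suc n) , s≤s z≤n , ≤-refl , right

unique-↭ : ∀ {A : Set} {xs ys : List A} → xs ↭ ys → Unique xs → Unique ys
unique-↭ {A} σ = SetoidPermutation.Unique-resp-↭ (setoid A) (↭⇒↭ₛ σ)

module Tower (k N : ℕ) where

  Peg : Set
  Peg = Fin (suc k)

  Leaf : Set
  Leaf = Fin k

  Conf : Set
  Conf = Config k N

  -- Pointwise agreement is needed because
  -- configurations are functions and we have no function extensionality.
  data Reach : ℕ → Conf → Conf → Set where
    stay    : ∀ {m c c'} → c ≗ c' → Reach m c c'
    advance : ∀ {m c c' c''} → Move c c' → Reach m c' c'' → Reach (suc m) c c''

  Move-resp : ∀ {c₀ c c' c₀' : Conf} → c₀ ≗ c → c' ≗ c₀' → Move c c' → Move c₀ c₀'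
  Move-resp {c₀} {c} {c'} {c₀'} eq eq' (d , adjacent , clear , others) =
    d , subst₂ (StarAdj {k}) (sym (eq d)) (eq' d) adjacent
      , (λ e e<d → (λ h → proj₁ (clear e e<d) (trans (sym (eq e)) (trans h (eq d))))
                 , (λ h → proj₂ (clear e e<d) (trans (sym (eq e)) (trans h (sym (eq' d))))))
      , (λ e e≢d → trans (sym (eq' e)) (trans (others e e≢d) (sym (eq e))))

  Reach-respˡ : ∀ {m c₀ c c'} → c₀ ≗ c → Reach m c c' → Reach m c₀ c'
  Reach-respˡ eq (stay same) = stay (λ d → trans (eq d) (same d))
  Reach-respˡ eq (advance mv r) = advance (Move-resp eq (λ _ → refl) mv) r

  Reach-respʳ : ∀ {m c c' c₀'} → c' ≗ c₀' → Reach m c c' → Reach m c c₀'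
  Reach-respʳ eq (stay same) = stay (λ d → trans (same d) (eq d))
  Reach-respʳ eq (advance mv r) = advance mv (Reach-respʳ eq r)

  Reach-weaken : ∀ {m m' c c'} → m ≤ m' → Reach m c c' → Reach m' c c'
  Reach-weaken _ (stay same) = stay same
  Reach-weaken (s≤s m≤m') (advance mv r) = advance mv (Reach-weaken m≤m' r)

  infixr 5 _⨾_
  _⨾_ : ∀ {m m' c c' c''} → Reach m c c' → Reach m' c' c'' → Reach (m + m') c c''
  _⨾_ {m} {m'} (stay same) r = Reach-weaken (m≤n+m m' m) (Reach-respˡ same r)
  advance mv r ⨾ r' = advance mv (r ⨾ r')

  Reach⇒ReachIn : ∀ {m c c'} → Reach m c c' → ReachIn m c c' ⊎ c ≗ c'
  Reach⇒ReachIn (stay same) = inj₂ same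
  Reach⇒ReachIn (advance mv r) with Reach⇒ReachIn r
  ... | inj₁ r' = inj₁ (step mv r')
  ... | inj₂ same = inj₁ (step (Move-resp (λ _ → refl) same mv) done)

  InBlock : ℕ → ℕ → Fin N → Set
  InBlock lo s d = lo ≤ toℕ d × toℕ d < lo + s

  inBlock? : ∀ lo s d → Dec (InBlock lo s d)
  inBlock? lo s d = (lo ≤? toℕ d) ×-dec (suc (toℕ d) ≤? lo + s)

  lower⊆ : ∀ {lo u t d} → InBlock lo u d → InBlock lo (u + t) d
  lower⊆ {lo} {u} {t} (lo≤d , d<) =
    lo≤d , <-≤-trans d< (≤-trans (m≤m+n (lo + u) t) (≤-reflexive (+-assoc lo u t)))

  upper⊆ : ∀ {lo u t d} → InBlock (lo + u) t d → InBlock lo (u + t) d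
  upper⊆ {lo} {u} {t} {d} (lo+u≤d , d<) =
    ≤-trans (m≤m+n lo u) lo+u≤d , subst (toℕ d <_) (+-assoc lo u t) d<

  block-split : ∀ {lo u t d} → InBlock lo (u + t) d → InBlock lo u d ⊎ InBlock (lo + u) t d
  block-split {lo} {u} {t} {d} (lo≤d , d<) with toℕ d <? lo + u
  ... | yes d<lo+u = inj₁ (lo≤d , d<lo+u)
  ... | no d≮lo+u = inj₂ (≮⇒≥ d≮lo+u , subst (toℕ d <_) (sym (+-assoc lo u t)) d<)

  lower∩upper : ∀ {lo u t d} → InBlock lo u d → ¬ InBlock (lo + u) t d
  lower∩upper (_ , d<lo+u) (lo+u≤d , _) = <⇒≱ d<lo+u lo+u≤d

  below-block : ∀ {lo s d} → toℕ d < lo → ¬ InBlock lo s d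
  below-block d<lo (lo≤d , _) = <⇒≱ d<lo lo≤d

  empty-block : ∀ {lo d} → ¬ InBlock lo 0 d
  empty-block {lo} (lo≤d , d<) = <⇒≱ (subst (_ <_) (+-identityʳ lo) d<) lo≤d

  singleton-block : ∀ {L d} → toℕ d ≡ L → InBlock L 1 d
  singleton-block {L} {d} refl = ≤-refl , subst (toℕ d <_) (+-comm 1 L) ≤-refl

  singleton-block⁻ : ∀ {L d} → InBlock L 1 d → toℕ d ≡ L
  singleton-block⁻ {L} {d} (L≤d , d<) = ≤-antisym (m<1+n⇒m≤n (subst (toℕ d <_) (+-comm L 1) d<)) L≤d

  abstract
    relocate : Conf → ℕ → ℕ → Peg → Conf
    relocate c lo s x d with inBlock? lo s d
    ... | yes _ = x
    ... | no _ = c d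

    relocate-in : ∀ c lo s x d → InBlock lo s d → relocate c lo s x d ≡ x
    relocate-in c lo s x d inside with inBlock? lo s d
    ... | yes _ = refl
    ... | no outside = contradiction inside outside

    relocate-out : ∀ c lo s x d → ¬ InBlock lo s d → relocate c lo s x d ≡ c d
    relocate-out c lo s x d outside with inBlock? lo s d
    ... | yes inside = contradiction inside outside
    ... | no _ = refl

  OnPeg : Conf → ℕ → ℕ → Peg → Set
  OnPeg c lo s x = ∀ d → InBlock lo s d → c d ≡ x

  OnPeg-relocate : ∀ c lo s x → OnPeg (relocate c lo s x) lo s x
  OnPeg-relocate c lo s x = relocate-in c lo s x

  OnPeg-below : ∀ {c lo s t x y} → OnPeg c lo s x → OnPeg (relocate c (lo + s) t y) lo s x
  OnPeg-below {c} {lo} {s} {t} {x} {y} onX d inside =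
    trans (relocate-out c (lo + s) t y d (lower∩upper inside)) (onX d inside)

  OnPeg-above : ∀ {c lo u t x y} → OnPeg c (lo + u) t x → OnPeg (relocate c lo u y) (lo + u) t x
  OnPeg-above {c} {lo} {u} {t} {x} {y} onX d inside =
    trans (relocate-out c lo u y d (λ lower → lower∩upper lower inside)) (onX d inside)

  Frame : Conf → Conf → ℕ → ℕ → Set
  Frame c c' lo s = ∀ d → ¬ InBlock lo s d → c' d ≡ c d

  Frame-refl : ∀ {c lo s} → Frame c c lo s
  Frame-refl _ _ = refl

  Frame-lower : ∀ {c c' lo u t x} → Frame c c' lo (u + t) → Frame c (relocate c' lo u x) lo (u + t)
  Frame-lower {c} {c'} {lo} {u} {t} {x} frame d outside =
    trans (relocate-out c' lo u x d (λ lower → outside (lower⊆ lower))) (frame d outside)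

  Frame-upper : ∀ {c c' lo u t x} → Frame c c' lo (u + t) → Frame c (relocate c' (lo + u) t x) lo (u + t)
  Frame-upper {c} {c'} {lo} {u} {t} {x} frame d outside =
    trans (relocate-out c' (lo + u) t x d (λ upper → outside (upper⊆ upper))) (frame d outside)

  relocate-merge : ∀ {c c' lo u t x} → Frame c c' lo (u + t) → OnPeg c' (lo + u) t x →
    relocate c' lo u x ≗ relocate c lo (u + t) x
  relocate-merge {c} {c'} {lo} {u} {t} {x} frame upperOnX d with inBlock? lo (u + t) d
  ... | no outside =
    trans (relocate-out c' lo u x d (λ lower → outside (lower⊆ lower)))
          (trans (frame d outside) (sym (relocate-out c lo (u + t) x d outside)))
  ... | yes inside with block-split {lo} {u} {t} inside
  ...   | inj₁ lower =
    trans (relocate-in c' lo u x d lower) (sym (relocate-in c lo (u + t) x d inside))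
  ...   | inj₂ upper =
    trans (relocate-out c' lo u x d (λ lower → lower∩upper lower upper))
          (trans (upperOnX d upper) (sym (relocate-in c lo (u + t) x d inside)))

  Idle : List Leaf → Peg → Set
  Idle ls zero = ⊥
  Idle ls (suc x) = x ∉ ls

  idle-≢-centre : ∀ {ls p} → Idle ls p → p ≢ zero
  idle-≢-centre {p = zero} ()
  idle-≢-centre {p = suc _} _ ()

  idle-≢-leaf : ∀ {ls p x} → Idle ls p → x ∈ ls → p ≢ suc x
  idle-≢-leaf {p = zero} ()
  idle-≢-leaf {p = suc _} x∉ x∈ refl = x∉ x∈

  Parked : Conf → ℕ → List Leaf → Set
  Parked c lo ls = ∀ d → toℕ d < lo → Idle ls (c d)

  Parked-⊆ : ∀ {c lo ls ls'} → (∀ {x} → x ∈ ls → x ∈ ls') → Parked c lo ls' → Parked c lo ls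
  Parked-⊆ {c} sub parked d d<lo with c d | parked d d<lo
  ... | zero | ()
  ... | suc _ | x∉ls' = λ x∈ls → x∉ls' (sub x∈ls)

  Parked-↭ : ∀ {c lo ls ls'} → ls ↭ ls' → Parked c lo ls → Parked c lo ls'
  Parked-↭ σ = Parked-⊆ (∈-resp-↭ (↭-sym σ))

  Parked-relocate : ∀ {c lo lo' s x ls} → lo ≤ lo' → Parked c lo ls → Parked (relocate c lo' s x) lo ls
  Parked-relocate {c} {lo} {lo'} {s} {x} lo≤lo' parked d d<lo =
    subst (Idle _) (sym (relocate-out c lo' s x d (below-block (<-≤-trans d<lo lo≤lo')))) (parked d d<lo)

  Parked-extend : ∀ {c lo u e ls} → Parked c lo ls → OnPeg c lo u (suc e) → e ∉ ls → Parked c (lo + u) ls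
  Parked-extend {c} {lo} {u} parked onE e∉ d d< with toℕ d <? lo
  ... | yes d<lo = parked d d<lo
  ... | no d≮lo = subst (Idle _) (sym (onE d (≮⇒≥ d≮lo , d<))) e∉

  clear-below : ∀ {c lo n ls x y z} → Parked c lo ls → (∀ {p} → Idle ls p → p ≢ x × p ≢ y) →
    OnPeg c lo n z → z ≢ x → z ≢ y → ∀ d → toℕ d < lo + n → c d ≢ x × c d ≢ y
  clear-below {c} {lo} parked avoid onZ z≢x z≢y d d< with toℕ d <? lo
  ... | yes d<lo = avoid (parked d d<lo)
  ... | no d≮lo = subst (λ p → p ≢ _ × p ≢ _) (sym (onZ d (≮⇒≥ d≮lo , d<))) (z≢x , z≢y)

  moveDisk : ∀ c L (L<N : L < N) x y → StarAdj x y → c (fromℕ< L<N) ≡ x →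
    (∀ d → toℕ d < L → c d ≢ x × c d ≢ y) → Reach 1 c (relocate c L 1 y)
  moveDisk c L L<N x y adjacent onX clear =
    advance (D , subst₂ (StarAdj {k}) (sym onX) (sym onY) adjacent , clearD , others) (stay (λ _ → refl))
    where
      D : Fin N
      D = fromℕ< L<N
      onY : relocate c L 1 y D ≡ y
      onY = relocate-in c L 1 y D (singleton-block (toℕ-fromℕ< L<N))
      clearD : ∀ e → toℕ e < toℕ D → c e ≢ c D × c e ≢ relocate c L 1 y D
      clearD e e<D with clear e (subst (toℕ e <_) (toℕ-fromℕ< L<N) e<D)
      ... | e≢x , e≢y = (λ h → e≢x (trans h onX)) , (λ h → e≢y (trans h onY))
      others : ∀ e → e ≢ D → relocate c L 1 y e ≡ c e
      others e e≢D = relocate-out c L 1 y e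
        (λ inside → e≢D (toℕ-injective (trans (singleton-block⁻ inside) (sym (toℕ-fromℕ< L<N)))))

  moveUnderBlock : ∀ {c lo n ls x y z} (L<N : lo + n < N) → StarAdj x y → c (fromℕ< L<N) ≡ x →
    Parked c lo ls → (∀ {p} → Idle ls p → p ≢ x × p ≢ y) → OnPeg c lo n z → z ≢ x → z ≢ y →
    Reach 1 c (relocate c (lo + n) 1 y)
  moveUnderBlock {c} {lo} {n} {x = x} {y} L<N adjacent onX parked avoid onZ z≢x z≢y =
    moveDisk c (lo + n) L<N x y adjacent onX (clear-below parked avoid onZ z≢x z≢y)

  CanMove : ℕ → ℕ → ℕ → Set
  CanMove j s m = ∀ lo → lo + s ≤ N → ∀ a b rest → Unique (a ∷ b ∷ rest) → length rest ≡ j →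
    ∀ c → OnPeg c lo s (suc a) → Parked c lo (a ∷ b ∷ rest) → Reach m c (relocate c lo s (suc b))

  canMove-empty : ∀ {j m} → CanMove j 0 m
  canMove-empty lo _ a b _ _ _ c _ _ = stay (λ d → sym (relocate-out c lo 0 (suc b) d empty-block))

  -- With no free leaf, each disk passes through the centre: G₃(n+1) = 3 G₃(n) + 2.
  canMove-three : ∀ {n m} → CanMove 0 n m → CanMove 0 (suc n) (3 * m + 2)
  canMove-three {n} {m} mv = subst (λ s → CanMove 0 s (3 * m + 2)) (+-comm n 1) three
    where
      open +-*-Solver
      cost : m + (1 + (m + (1 + m))) ≡ 3 * m + 2
      cost = solve 1 (λ m → m :+ (con 1 :+ (m :+ (con 1 :+ m))) := con 3 :* m :+ con 2) refl m

      three : CanMove 0 (n + 1) (3 * m + 2)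
      three lo bound a b (_ ∷ _) _ ()
      three lo bound a b [] uniq@((a≢b ∷ []) ∷ _) refl c onA parked =
        Reach-weaken (≤-reflexive cost) (Reach-respʳ finish
          (mv lo lo+n≤N a b [] uniq refl c (λ d p → onA d (lower⊆ p)) parked
          ⨾ moveUnderBlock L<N tt c₁D (Parked-relocate ≤-refl parked) avoid₁
              (OnPeg-relocate c lo n (suc b)) (λ h → a≢b (sym (fsuc-injective h))) (λ ())
          ⨾ mv lo lo+n≤N b a [] uniqBA refl c₂ (OnPeg-below (OnPeg-relocate c lo n (suc b))) parkedBA
          ⨾ moveUnderBlock L<N tt c₃D parked₃ avoid₃
              (OnPeg-relocate c₂ lo n (suc a)) (λ ()) (λ h → a≢b (fsuc-injective h))
          ⨾ mv lo lo+n≤N a b [] uniq refl c₄ (OnPeg-below (OnPeg-relocate c₂ lo n (suc a))) parked₄))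
        where
          L : ℕ
          L = lo + n
          L<N : L < N
          L<N = subst (_≤ N) (trans (sym (+-assoc lo n 1)) (+-comm L 1)) bound
          lo+n≤N : L ≤ N
          lo+n≤N = <⇒≤ L<N
          D : Fin N
          D = fromℕ< L<N
          D-bottom : InBlock L 1 D
          D-bottom = singleton-block (toℕ-fromℕ< L<N)
          D-not-top : ¬ InBlock lo n D
          D-not-top top = lower∩upper top D-bottom
          c₁ c₂ c₃ c₄ : Conf
          c₁ = relocate c lo n (suc b)
          c₂ = relocate c₁ L 1 zero
          c₃ = relocate c₂ lo n (suc a)
          c₄ = relocate c₃ L 1 (suc b)
          avoid₁ : ∀ {p} → Idle (a ∷ b ∷ []) p → p ≢ suc a × p ≢ zero
          avoid₁ idle = idle-≢-leaf idle (here refl) , idle-≢-centre idle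
          avoid₃ : ∀ {p} → Idle (a ∷ b ∷ []) p → p ≢ zero × p ≢ suc b
          avoid₃ idle = idle-≢-centre idle , idle-≢-leaf idle (there (here refl))
          parked₂ : Parked c₂ lo (a ∷ b ∷ [])
          parked₂ = Parked-relocate (m≤m+n lo n) (Parked-relocate ≤-refl parked)
          parked₃ : Parked c₃ lo (a ∷ b ∷ [])
          parked₃ = Parked-relocate ≤-refl parked₂
          parked₄ : Parked c₄ lo (a ∷ b ∷ [])
          parked₄ = Parked-relocate (m≤m+n lo n) parked₃
          uniqBA : Unique (b ∷ a ∷ [])
          uniqBA = ((λ h → a≢b (sym h)) ∷ []) ∷ [] ∷ []
          parkedBA : Parked c₂ lo (b ∷ a ∷ [])
          parkedBA = Parked-↭ (↭-swap a b ↭-refl) parked₂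
          c₁D : c₁ D ≡ suc a
          c₁D = trans (relocate-out c lo n (suc b) D D-not-top) (onA D (upper⊆ D-bottom))
          c₃D : c₃ D ≡ zero
          c₃D = trans (relocate-out c₂ lo n (suc a) D D-not-top) (relocate-in c₁ L 1 zero D D-bottom)
          finish : relocate c₄ lo n (suc b) ≗ relocate c lo (n + 1) (suc b)
          finish = relocate-merge (Frame-upper (Frame-lower (Frame-upper (Frame-lower Frame-refl))))
            (OnPeg-relocate c₃ L 1 (suc b))

  -- With a free leaf e: park the top u disks on e, move the bottom t disks
  -- without e, then bring the top u disks onto b: the Frame–Stewart step.
  canMove-split : ∀ {j u t m₁ m₂} → CanMove (suc j) u m₁ → CanMove j t m₂ →
    CanMove (suc j) (u + t) (2 * m₁ + m₂)
  canMove-split mv₁ mv₂ lo bound a b [] uniq ()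
  canMove-split {j} {u} {t} {m₁} {m₂} mv₁ mv₂ lo bound a b (e ∷ rest) uniq len c onA parked =
    Reach-weaken (≤-reflexive cost) (Reach-respʳ finish
      (mv₁ lo bound₁ a e (b ∷ rest) (unique-↭ σ₁ uniq) len c (λ d p → onA d (lower⊆ p))
           (Parked-↭ σ₁ parked)
      ⨾ mv₂ (lo + u) bound₂ a b rest uniq₂ (suc-injective len) c₁ onA₂ parked₂
      ⨾ mv₁ lo bound₁ e b (a ∷ rest) (unique-↭ σ₃ uniq) len c₂ (OnPeg-below (OnPeg-relocate c lo u (suc e)))
           parked₃))
    where
      open +-*-Solver
      cost : m₁ + (m₂ + m₁) ≡ 2 * m₁ + m₂
      cost = solve 2 (λ m₁ m₂ → m₁ :+ (m₂ :+ m₁) := con 2 :* m₁ :+ m₂) refl m₁ m₂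

      bound₂ : lo + u + t ≤ N
      bound₂ = subst (_≤ N) (sym (+-assoc lo u t)) bound
      bound₁ : lo + u ≤ N
      bound₁ = ≤-trans (m≤m+n (lo + u) t) bound₂
      σ₁ : a ∷ b ∷ e ∷ rest ↭ a ∷ e ∷ b ∷ rest
      σ₁ = ↭-prep a (↭-swap b e ↭-refl)
      σ₂ : a ∷ b ∷ e ∷ rest ↭ e ∷ a ∷ b ∷ rest
      σ₂ = ↭-trans σ₁ (↭-swap a e ↭-refl)
      σ₃ : a ∷ b ∷ e ∷ rest ↭ e ∷ b ∷ a ∷ rest
      σ₃ = ↭-trans (↭-swap a b ↭-refl)
             (↭-trans (↭-prep b (↭-swap a e ↭-refl)) (↭-swap b e ↭-refl))
      e∉ : e ∉ a ∷ b ∷ rest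
      e∉ = Unique[x∷xs]⇒x∉xs (unique-↭ σ₂ uniq)
      uniq₂ : Unique (a ∷ b ∷ rest)
      uniq₂ with unique-↭ σ₂ uniq
      ... | _ ∷ tail = tail
      c₁ c₂ : Conf
      c₁ = relocate c lo u (suc e)
      c₂ = relocate c₁ (lo + u) t (suc b)
      onA₂ : OnPeg c₁ (lo + u) t (suc a)
      onA₂ = OnPeg-above (λ d p → onA d (upper⊆ p))
      parked₂ : Parked c₁ (lo + u) (a ∷ b ∷ rest)
      parked₂ = Parked-extend
        (Parked-relocate ≤-refl (Parked-⊆ (λ x∈ → ∈-resp-↭ (↭-sym σ₂) (there x∈)) parked))
        (OnPeg-relocate c lo u (suc e)) e∉
      parked₃ : Parked c₂ lo (e ∷ b ∷ a ∷ rest)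
      parked₃ = Parked-↭ σ₃ (Parked-relocate (m≤m+n lo u) (Parked-relocate ≤-refl parked))
      finish : relocate c₂ lo u (suc b) ≗ relocate c lo (u + t) (suc b)
      finish = relocate-merge (Frame-upper (Frame-lower Frame-refl)) (OnPeg-relocate c₁ (lo + u) t (suc b))

  towerMove-split : ∀ {j f n} → n ≤ f →
    (∀ u → u ≤ f → CanMove (suc j) u (Gf pStar qStar (suc j) f u)) →
    (∀ t → t ≤ suc n → CanMove j t (Gf pStar qStar j (suc n) t)) →
    CanMove (suc j) (suc n) (Gf pStar qStar (suc j) (suc f) (suc n))
  towerMove-split {j} {f} {n} n≤f upper lower
    with minOver-attained (λ t → 2 * Gf pStar qStar (suc j) f (suc n ∸ t) + 1 * Gf pStar qStar j (suc n) t) n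
  ... | t , 1≤t , t≤1+n , attained =
    subst₂ (CanMove (suc j)) (m∸n+n≡m t≤1+n)
      (sym (trans attained (cong (2 * Gf pStar qStar (suc j) f (suc n ∸ t) +_)
                                 (*-identityˡ (Gf pStar qStar j (suc n) t)))))
      (canMove-split (upper (suc n ∸ t) (≤-trans (∸-monoʳ-≤ (suc n) 1≤t) n≤f)) (lower t t≤1+n))

  towerMove : ∀ j f s → s ≤ f → CanMove j s (Gf pStar qStar j f s)
  towerMove j zero zero _ = canMove-empty
  towerMove zero (suc f) zero _ = canMove-empty
  towerMove (suc j) (suc f) zero _ = canMove-empty
  towerMove zero (suc f) (suc n) (s≤s n≤f) = canMove-three (towerMove zero f n n≤f)
  towerMove (suc j) (suc f) (suc n) (s≤s n≤f) = towerMove-split n≤f (towerMove (suc j) f) (towerMove j (suc n))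

  transfer : 0 < N → ∀ {j} a b others → Unique (a ∷ b ∷ others) → length others ≡ j →
    ReachIn (Gf pStar qStar j N N) (pile N (suc a)) (pile N (suc b))
  transfer 0<N a b others uniq@((a≢b ∷ _) ∷ _) len
    with Reach⇒ReachIn (Reach-respʳ wholeTower
           (towerMove _ N N ≤-refl 0 ≤-refl a b others uniq len (pile N (suc a)) (λ _ _ → refl) (λ _ ())))
    where
      wholeTower : relocate (pile N (suc a)) 0 N (suc b) ≗ pile N (suc b)
      wholeTower d = relocate-in (pile N (suc a)) 0 N (suc b) d (z≤n , toℕ<n d)
  ... | inj₁ r = r
  ... | inj₂ same = contradiction (fsuc-injective (same (fromℕ< 0<N))) a≢b

otherLeaves : ∀ {k'} {i j : Fin (suc (suc k'))} → i ≢ j → List (Fin (suc (suc k')))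
otherLeaves {i = i} i≢j = tabulate (λ x → punchIn i (punchIn (punchOut i≢j) x))

otherLeaves-unique : ∀ {k'} {i j : Fin (suc (suc k'))} (i≢j : i ≢ j) → Unique (i ∷ j ∷ otherLeaves i≢j)
otherLeaves-unique {k'} {i} {j} i≢j =
  (i≢j ∷ tabulate⁺ (λ x h → punchInᵢ≢i i _ (sym h))) ∷ tabulate⁺ j≢ ∷ unique-tabulate injective
  where
    j' : Fin (suc k')
    j' = punchOut i≢j
    j≢ : ∀ x → j ≢ punchIn i (punchIn j' x)
    j≢ x h = punchInᵢ≢i j' x (sym (punchIn-injective i _ _ (trans (punchIn-punchOut i≢j) h)))
    injective : ∀ {x y} → punchIn i (punchIn j' x) ≡ punchIn i (punchIn j' y) → x ≡ y
    injective h = punchIn-injective j' _ _ (punchIn-injective i _ _ h)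

theorem3 : (k n : ℕ) → 2 ≤ k → 1 ≤ n → (i j : Fin k) → i ≢ j →
    ReachIn {k} {n} (GFS pStar qStar (suc k) n) (pile n (suc i)) (pile n (suc j))
theorem3 (suc (suc k')) (suc n') (s≤s (s≤s z≤n)) (s≤s z≤n) i j i≢j =
  Tower.transfer (suc (suc k')) (suc n') (s≤s z≤n) {k'} i j (otherLeaves i≢j) (otherLeaves-unique i≢j)
    (length-tabulate _)
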